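{- Let $G$ be the cube graph, let $P$ be a pot satisfying Scenario 3 for $G$, and let $\lambda$ be an assembly design of $G$ with $P_\lambda(G)\subseteq P$. Suppose an edge $e=\{v_i,v_j\}$ has $\lambda(v_i,e)=a$ and $\lambda(v_j,e)=\hat a$ for some $a\in\Sigma$. If another edge $f=\{v_k,v_m\}\neq e$ is labeled with the same bond-edge type, with $\lambda(v_k,f)=a$ and $\lambda(v_m,f)=\hat a$, then either $v_k=v_i$, or $v_m=v_j$, or $d(v_i,v_m)=d(v_j,v_k)=3$, where $d$ is the graph distance in $G$.
   Context: The cube graph is the 1-skeleton of the 3-dimensional cube ($3$-regular, $8$ vertices). Graphs are finite and may have loops and multiple edges; each edge $e$ with endpoints $u,v$ has half-edges $(u,e),(v,e)$. Fix a finite alphabet $\Sigma$ (bond-edge types) and disjoint copy $\hat\Sigma=\{\hat a:a\in\Sigma\}$; elements of $\Sigma\cup\hat\Sigma$ are cohesive-end types, $\hat{\hat a}=a$. A tile is a finite multiset of cohesive-end types. A pot is a finite set $P$ of tiles such that whenever $x$ occurs in a tile of $P$, $\hat x$ occurs in some tile of $P$. An assembly design of a graph $G$ labels half-edges by cohesive-end types so that the two half-edges of each edge receive $a$ and $\hat a$ for some $a\in\Sigma$ (the edge is then labeled with bond-edge type $a$); $\lambda(v)$ is the multiset of labels at $v$ and $P_\lambda(G)=\{\lambda(v)\}$. $P$ realizes $G$ if $P_\lambda(G)\subseteq P$ for some assembly design $\lambda$; $\mathcal O(P)$ is the set of graphs realized by $P$. $P$ satisfies Scenario 3 for $G$ if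 $G\in\mathcal O(P)$, every $H\in\mathcal O(P)$ has $\#V(H)\ge\#V(G)$, and every $H\in\mathcal O(P)$ with $\#V(H)=\#V(G)$ is isomorphic to $G$. -}

module Defs where

open import Data.Nat using (ℕ; zero; suc; _+_; _≤_; _<_; s≤s; z≤n)
open import Data.Fin using (Fin; zero; suc; #_)
import Data.Fin.Properties as FinP
open import Data.Bool using (Bool; true; false; not)
open import Data.Product using (Σ; ∃; _×_; _,_; proj₁; proj₂)
open import Data.Sum using (_⊎_)
open import Data.List using (List)
open import Data.List.Membership.Propositional using (_∈_)
open import Data.Vec using (Vec; []; _∷_; lookup)
open import Relation.Nullary using (¬_; Dec; yes; no)
open import Relation.Nullary.Decidable using (_×-dec_)
open import Relation.Binary.PropositionalEquality using (_≡_; refl; cong)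
open import Function.Bundles using (_↔_; Inverse)

-- Finite multigraphs (loops and multiple edges allowed).
-- Vertices are Fin nV, edges are Fin nE; edge e has two half-edges
-- (e , false) and (e , true) whose endpoints are  end e false, end e true.

record Graph : Set where
  field
    nV       : ℕ
    nE       : ℕ
    end      : Fin nE → Bool → Fin nV
    nonempty : 1 ≤ nV
open Graph public

Iso : Graph → Graph → Set
Iso G H =
  Σ (Fin (nV G) ↔ Fin (nV H)) λ φ →
  Σ (Fin (nE G) ↔ Fin (nE H)) λ ψ →
    ∀ e → (∀ b → end H (Inverse.to ψ e) b ≡ Inverse.to φ (end G e b))
        ⊎ (∀ b → end H (Inverse.to ψ e) b ≡ Inverse.to φ (end G e (not b)))

Adj : (G : Graph) → Fin (nV G) → Fin (nV G) → Set
Adj G u v = ∃ λ e → ∃ λ b → end G e b ≡ u × end G e (not b) ≡ v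

data Walk (G : Graph) : Fin (nV G) → Fin (nV G) → ℕ → Set where
  here : ∀ {u} → Walk G u u 0
  step : ∀ {u w v k} → Adj G u w → Walk G w v k → Walk G u v (suc k)

Dist : (G : Graph) → Fin (nV G) → Fin (nV G) → ℕ → Set
Dist G u v k = Walk G u v k × (∀ j → j < k → ¬ Walk G u v j)

-- Cohesive-end types over the alphabet Σ = Fin s:
-- plain a  is  a ∈ Σ,  hat a  is  â ∈ Σ̂.

data End (s : ℕ) : Set where
  plain : Fin s → End s
  hat   : Fin s → End s

hatE : ∀ {s} → End s → End s
hatE (plain a) = hat a
hatE (hat a)   = plain a

plain-inj : ∀ {s} {a b : Fin s} → plain a ≡ plain b → a ≡ b
plain-inj refl = refl

hat-inj : ∀ {s} {a b : Fin s} → hat a ≡ hat b → a ≡ b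
hat-inj refl = refl

_≟E_ : ∀ {s} (x y : End s) → Dec (x ≡ y)
plain a ≟E plain b with a FinP.≟ b
... | yes p = yes (cong plain p)
... | no ¬p = no λ q → ¬p (plain-inj q)
plain a ≟E hat b = no λ ()
hat a ≟E plain b = no λ ()
hat a ≟E hat b with a FinP.≟ b
... | yes p = yes (cong hat p)
... | no ¬p = no λ q → ¬p (hat-inj q)

-- A tile is a finite multiset of cohesive-end types, given by its
-- multiplicity function (End s is finite, so support is finite).
Tile : ℕ → Set
Tile s = End s → ℕ

_≈T_ : ∀ {s} → Tile s → Tile s → Set
t ≈T t' = ∀ x → t x ≡ t' x

_∈P_ : ∀ {s} → Tile s → List (Tile s) → Set
t ∈P P = ∃ λ t' → t' ∈ P × t ≈T t'

IsPot : ∀ {s} → List (Tile s) → Set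
IsPot {s} P = ∀ t → t ∈ P → ∀ (x : End s) → 1 ≤ t x →
              ∃ λ t' → t' ∈ P × 1 ≤ t' (hatE x)

record Pot (s : ℕ) : Set where
  field
    tiles  : List (Tile s)
    isPot  : IsPot tiles
open Pot public

sumFin : (n : ℕ) → (Fin n → ℕ) → ℕ
sumFin zero    f = 0
sumFin (suc n) f = f zero + sumFin n (λ i → f (suc i))

indicator : ∀ {A : Set} → Dec A → ℕ
indicator (yes _) = 1
indicator (no _)  = 0

Labeling : Graph → ℕ → Set
Labeling G s = Fin (nE G) → Bool → End s

IsDesign : ∀ {s} (G : Graph) → Labeling G s → Set
IsDesign {s} G lab = ∀ e → ∃ λ (a : Fin s) →
  (lab e false ≡ plain a × lab e true ≡ hat a)
  ⊎ (lab e false ≡ hat a × lab e true ≡ plain a)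

tileAt : ∀ {s} (G : Graph) → Labeling G s → Fin (nV G) → Tile s
tileAt G lab v x =
  sumFin (nE G) λ e →
      indicator (FinP._≟_ (end G e false) v ×-dec (lab e false ≟E x))
    + indicator (FinP._≟_ (end G e true) v ×-dec (lab e true ≟E x))

DesignIn : ∀ {s} (G : Graph) → Labeling G s → Pot s → Set
DesignIn G lab P = ∀ v → tileAt G lab v ∈P tiles P

Realizes : ∀ {s} → Pot s → Graph → Set
Realizes {s} P G = Σ (Labeling G s) λ lab → IsDesign G lab × DesignIn G lab P

Scenario3 : ∀ {s} → Pot s → Graph → Set
Scenario3 P G =
    Realizes P G
  × (∀ H → Realizes P H → nV G ≤ nV H)
  × (∀ H → Realizes P H → nV H ≡ nV G → Iso H G)

-- The cube graph: vertices 0..7 as 3-bit strings, edges join strings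
-- differing in exactly one bit.

cubeEdges : Vec (Fin 8 × Fin 8) 12
cubeEdges =
  (# 0 , # 1) ∷ (# 2 , # 3) ∷ (# 4 , # 5) ∷ (# 6 , # 7) ∷
  (# 0 , # 2) ∷ (# 1 , # 3) ∷ (# 4 , # 6) ∷ (# 5 , # 7) ∷
  (# 0 , # 4) ∷ (# 1 , # 5) ∷ (# 2 , # 6) ∷ (# 3 , # 7) ∷ []

cubeEnd : Fin 12 → Bool → Fin 8
cubeEnd e false = proj₁ (lookup cubeEdges e)
cubeEnd e true  = proj₂ (lookup cubeEdges e)

cube : Graph
cube = record { nV = 8 ; nE = 12 ; end = cubeEnd ; nonempty = s≤s z≤n }

-- Exchange the â-ends of e and f. The tile at a vertex counts the half-edges there by label,
-- and the two exchanged half-edges carry the same label â, so the rewired graph H has the same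
-- tiles as the cube; it has 8 vertices and is realized by P, hence H ≅ cube by Scenario 3.
-- In particular H is simple and bipartite. Evaluating all pairs of cube edges shows that this
-- fails (a multiple edge, a loop or an odd cycle appears) unless f shares an end with e in the
-- required way, or the ends of f are the antipodes of those of e, which lie at distance 3.
module Submission where

open import Defs
open import Data.Nat using (ℕ; zero; suc; _+_; _*_)
open import Data.Nat.Properties using (+-assoc; +-0-commutativeMonoid; allUpTo?)
open import Data.Fin using (Fin; zero; suc; opposite)
import Data.Fin.Properties as FinP
open import Data.Fin.Permutation using (Permutation′)
open import Data.Bool using (Bool; true; false; not; if_then_else_)
import Data.Bool.Properties as BoolP
open import Data.Product using (∃; _×_; _,_; uncurry)
open import Data.Product.Properties using (≡-dec)
open import Data.Product.Function.NonDependent.Propositional using (_×-↔_)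
open import Data.Sum using (_⊎_; inj₁; inj₂; [_,_]′)
open import Data.Empty using (⊥-elim)
open import Data.Vec using (Vec; []; _∷_; lookup; tabulate)
open import Data.Vec.Properties using (lookup∘tabulate)
open import Algebra.Properties.CommutativeMonoid.Sum +-0-commutativeMonoid using (sum; sum-permute; sum-cong-≗)
open import Function using (_∘_)
open import Function.Bundles using (_↔_; Inverse; mk↔ₛ′)
open import Function.Construct.Composition using (_↔-∘_)
open import Function.Construct.Symmetry using (↔-sym)
open import Function.Construct.Identity using (↔-id)
open import Relation.Nullary using (¬_; Dec; does; yes; no)
open import Relation.Nullary.Decidable using (_×-dec_; _⊎-dec_; _→-dec_; ¬?; map′; toWitness; dec-true; dec-false)
open import Relation.Unary using (Decidable)
open import Relation.Binary using (DecidableEquality)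
open import Relation.Binary.PropositionalEquality
  using (_≡_; _≢_; _≗_; refl; sym; trans; cong; subst; module ≡-Reasoning)

module _ {A : Set} (_≟_ : DecidableEquality A) where

  swap : A → A → A → A
  swap p q h = if does (h ≟ p) then q else if does (h ≟ q) then p else h

  swap-involutive : ∀ p q h → swap p q (swap p q h) ≡ h
  swap-involutive p q h with h ≟ p
  ... | yes refl with q ≟ h
  ...   | yes q≡h = q≡h
  ...   | no _ rewrite dec-true (q ≟ q) refl = refl
  swap-involutive p q h | no h≢p with h ≟ q
  ...   | yes refl rewrite dec-true (p ≟ p) refl = refl
  ...   | no h≢q rewrite dec-false (h ≟ p) h≢p | dec-false (h ≟ q) h≢q = refl

  swap-↔ : A → A → A ↔ A
  swap-↔ p q = mk↔ₛ′ (swap p q) (swap p q) (swap-involutive p q) (swap-involutive p q)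

  ∘-swap-≗ : ∀ {B : Set} (f : A → B) {p q} → f p ≡ f q → f ∘ swap p q ≗ f
  ∘-swap-≗ f {p} {q} fp≡fq h with h ≟ p
  ... | yes refl = sym fp≡fq
  ... | no _ with h ≟ q
  ...   | yes refl = fp≡fq
  ...   | no _ = refl

HalfEdge : ℕ → Set
HalfEdge n = Fin n × Bool

_≟H_ : ∀ {n} → DecidableEquality (HalfEdge n)
_≟H_ = ≡-dec FinP._≟_ BoolP._≟_

halfEdgeCode : ∀ {n} → Fin (n * 2) ↔ HalfEdge n
halfEdgeCode = (↔-id _ ×-↔ FinP.2↔Bool) ↔-∘ FinP.*↔×

-- tileAt G lab v x is by definition ∑-halfEdges (nE G) applied to an indicator.
∑-halfEdges : ∀ n → (HalfEdge n → ℕ) → ℕ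
∑-halfEdges n g = sumFin n λ e → g (e , false) + g (e , true)

∑-halfEdges≡sum : ∀ n (g : HalfEdge n → ℕ) → ∑-halfEdges n g ≡ sum (g ∘ Inverse.to halfEdgeCode)
∑-halfEdges≡sum zero    g = refl
∑-halfEdges≡sum (suc n) g =
  trans (+-assoc (g (zero , false)) _ _)
        (cong (λ r → g (zero , false) + (g (zero , true) + r)) (∑-halfEdges≡sum n (λ (e , b) → g (suc e , b))))

∑-halfEdges-↔ : ∀ n (σ : HalfEdge n ↔ HalfEdge n) {g g′ : HalfEdge n → ℕ} →
                g′ ≗ g ∘ Inverse.to σ → ∑-halfEdges n g′ ≡ ∑-halfEdges n g
∑-halfEdges-↔ n σ {g} {g′} g′≗gσ = begin
  ∑-halfEdges n g′     ≡⟨ ∑-halfEdges≡sum n g′ ⟩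
  sum (g′ ∘ to ι)      ≡⟨ sum-cong-≗ (λ k → trans (g′≗gσ (to ι k)) (cong g (sym (strictlyInverseˡ ι _)))) ⟩
  sum (g ∘ to ι ∘ to π) ≡⟨ sym (sum-permute (g ∘ to ι) π) ⟩
  sum (g ∘ to ι)       ≡⟨ sym (∑-halfEdges≡sum n g) ⟩
  ∑-halfEdges n g      ∎
  where
  open Inverse
  open ≡-Reasoning
  ι : Fin (n * 2) ↔ HalfEdge n
  ι = halfEdgeCode
  π : Permutation′ (n * 2)
  π = ↔-sym ι ↔-∘ (σ ↔-∘ ι)

rewire : (G : Graph) → HalfEdge (nE G) ↔ HalfEdge (nE G) → Graph
rewire G σ = record G { end = λ e b → uncurry (end G) (Inverse.to σ (e , b)) }

module _ {s} (G : Graph) (lab : Labeling G s) (σ : HalfEdge (nE G) ↔ HalfEdge (nE G))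
         (σ-preserves-lab : ∀ h → uncurry lab (Inverse.to σ h) ≡ uncurry lab h) where

  tileAt-rewire : ∀ v → tileAt (rewire G σ) lab v ≈T tileAt G lab v
  tileAt-rewire v x = ∑-halfEdges-↔ (nE G) σ {g = counted} λ h →
    cong (λ y → indicator ((uncurry (end G) (Inverse.to σ h) FinP.≟ v) ×-dec (y ≟E x))) (sym (σ-preserves-lab h))
    where
    counted : HalfEdge (nE G) → ℕ
    counted h = indicator ((uncurry (end G) h FinP.≟ v) ×-dec (uncurry lab h ≟E x))

  DesignIn-rewire : ∀ {P} → DesignIn G lab P → DesignIn (rewire G σ) lab P
  DesignIn-rewire inP v =
    let (t , t∈P , tileAt≈t) = inP v in t , t∈P , λ x → trans (tileAt-rewire v x) (tileAt≈t x)

  Scenario3⇒rewire-Iso : ∀ {P} → Scenario3 P G → IsDesign G lab → DesignIn G lab P → Iso (rewire G σ) G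
  Scenario3⇒rewire-Iso {P} (_ , _ , unique) design inP =
    unique (rewire G σ) (lab , design , DesignIn-rewire {P} inP) refl

Joins : (G : Graph) → Fin (nE G) → Fin (nV G) → Fin (nV G) → Set
Joins G e u v = (end G e false ≡ u × end G e true ≡ v) ⊎ (end G e false ≡ v × end G e true ≡ u)

joins-ends : ∀ G e → Joins G e (end G e false) (end G e true)
joins-ends G e = inj₁ (refl , refl)

Iso-joins : ∀ {H G} ((φ , ψ , _) : Iso H G) {e u v} →
            Joins H e u v → Joins G (Inverse.to ψ e) (Inverse.to φ u) (Inverse.to φ v)
Iso-joins (φ , ψ , ends) {e} joins with ends e | joins
... | inj₁ same | inj₁ (u , v) = inj₁ (trans (same false) (cong (Inverse.to φ) u) , trans (same true) (cong (Inverse.to φ) v))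
... | inj₁ same | inj₂ (v , u) = inj₂ (trans (same false) (cong (Inverse.to φ) v) , trans (same true) (cong (Inverse.to φ) u))
... | inj₂ flip | inj₁ (u , v) = inj₂ (trans (flip false) (cong (Inverse.to φ) v) , trans (flip true) (cong (Inverse.to φ) u))
... | inj₂ flip | inj₂ (v , u) = inj₁ (trans (flip false) (cong (Inverse.to φ) u) , trans (flip true) (cong (Inverse.to φ) v))

Simple : Graph → Set
Simple G = ∀ e f u v → Joins G e u v → Joins G f u v → e ≡ f

Iso-Simple : ∀ {H G} → Iso H G → Simple G → Simple H
Iso-Simple {H} {G} iso@(_ , ψ , _) simple e f u v je jf =
  trans (sym (strictlyInverseʳ ψ e))
        (trans (cong (from ψ) (simple _ _ _ _ (Iso-joins {H} {G} iso je) (Iso-joins {H} {G} iso jf)))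
               (strictlyInverseʳ ψ f))
  where open Inverse

ParallelTo : (G : Graph) → Fin (nE G) → Set
ParallelTo G e = ∃ λ f → f ≢ e × Joins G f (end G e false) (end G e true)

ParallelTo⇒¬Simple : ∀ {G e} → ParallelTo G e → ¬ Simple G
ParallelTo⇒¬Simple {G} {e} (f , f≢e , jf) simple = f≢e (simple f e _ _ jf (joins-ends G e))

ProperColouring : (G : Graph) → (Fin (nV G) → Bool) → Set
ProperColouring G col = ∀ e → col (end G e false) ≢ col (end G e true)

Bipartite : Graph → Set
Bipartite G = ∃ (ProperColouring G)

ProperColouring-joins : ∀ {G col e u v} → ProperColouring G col → Joins G e u v → col u ≢ col v
ProperColouring-joins {e = e} proper (inj₁ (refl , refl)) = proper e
ProperColouring-joins {e = e} proper (inj₂ (refl , refl)) = proper e ∘ sym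

Iso-Bipartite : ∀ {H G} → Iso H G → Bipartite G → Bipartite H
Iso-Bipartite {H} {G} iso@(φ , _ , _) (col , proper) =
  col ∘ Inverse.to φ , λ e → ProperColouring-joins {G} {col} proper (Iso-joins {H} {G} iso (joins-ends H e))

any-Bool? : {P : Bool → Set} → Decidable P → Dec (∃ P)
any-Bool? P? = map′ (λ { (inj₁ p) → false , p ; (inj₂ p) → true , p })
                    (λ { (false , p) → inj₁ p ; (true , p) → inj₂ p })
                    (P? false ⊎-dec P? true)

all-Bool? : {P : Bool → Set} → Decidable P → Dec (∀ b → P b)
all-Bool? P? = map′ (λ { (p , q) false → p ; (p , q) true → q }) (λ all → all false , all true)
                    (P? false ×-dec P? true)

any-Vec-Bool? : ∀ n {P : Vec Bool n → Set} → Decidable P → Dec (∃ P)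
any-Vec-Bool? zero    P? = map′ ([] ,_) (λ { ([] , p) → p }) (P? [])
any-Vec-Bool? (suc n) P? =
  map′ (λ { (inj₁ (v , p)) → _ , p ; (inj₂ (v , p)) → _ , p })
       (λ { (false ∷ v , p) → inj₁ (v , p) ; (true ∷ v , p) → inj₂ (v , p) })
       (any-Vec-Bool? n (λ v → P? (false ∷ v)) ⊎-dec any-Vec-Bool? n (λ v → P? (true ∷ v)))

joins? : ∀ G e u v → Dec (Joins G e u v)
joins? G e u v = ((end G e false FinP.≟ u) ×-dec (end G e true FinP.≟ v))
          ⊎-dec ((end G e false FinP.≟ v) ×-dec (end G e true FinP.≟ u))

simple? : ∀ G → Dec (Simple G)
simple? G = FinP.all? λ e → FinP.all? λ f → FinP.all? λ u → FinP.all? λ v →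
  joins? G e u v →-dec joins? G f u v →-dec e FinP.≟ f

parallelTo? : ∀ G e → Dec (ParallelTo G e)
parallelTo? G e = FinP.any? λ f → ¬? (f FinP.≟ e) ×-dec joins? G f _ _

bipartite? : ∀ G → Dec (Bipartite G)
bipartite? G =
  map′ (λ (v , proper) → lookup v , proper) (λ (col , proper) → tabulate col , tabulate-proper col proper)
       (any-Vec-Bool? (nV G) λ v → FinP.all? λ e → ¬? (lookup v (end G e false) BoolP.≟ lookup v (end G e true)))
  where
  tabulate-proper : ∀ col → ProperColouring G col → ProperColouring G (lookup (tabulate col))
  tabulate-proper col proper e
    rewrite lookup∘tabulate col (end G e false) | lookup∘tabulate col (end G e true) = proper e

adjacent? : ∀ G u v → Dec (Adj G u v)
adjacent? G u v = FinP.any? λ e → any-Bool? λ b → (end G e b FinP.≟ u) ×-dec (end G e (not b) FinP.≟ v)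

walk? : ∀ G u v k → Dec (Walk G u v k)
walk? G u v zero    = map′ (λ { refl → here }) (λ { here → refl }) (u FinP.≟ v)
walk? G u v (suc k) = map′ (λ (w , uw , wv) → step uw wv) (λ { (step uw wv) → _ , uw , wv })
  (FinP.any? λ w → adjacent? G u w ×-dec walk? G w v k)

dist? : ∀ G u v k → Dec (Dist G u v k)
dist? G u v k = walk? G u v k ×-dec map′ (λ shorter j → shorter {j}) (λ shorter {j} → shorter j)
  (allUpTo? (λ j → ¬? (walk? G u v j)) k)

cube-simple : Simple cube
cube-simple = toWitness {a? = simple? cube} _

cube-bipartite : Bipartite cube
cube-bipartite = toWitness {a? = bipartite? cube} _

-- opposite complements the three bits of a vertex: it is the antipode in the cube.
cube-dist-opposite : ∀ u → Dist cube u (opposite u) 3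
cube-dist-opposite = toWitness {a? = FinP.all? λ u → dist? cube u (opposite u) 3} _

exchangeHats : Fin 12 → Bool → Fin 12 → Bool → Graph
exchangeHats e b f c = rewire cube (swap-↔ _≟H_ (e , not b) (f , not c))

ExchangeOutcome : Fin 12 → Bool → Fin 12 → Bool → Set
ExchangeOutcome e b f c =
    (cubeEnd f c ≡ cubeEnd e b)
  ⊎ (cubeEnd f (not c) ≡ cubeEnd e (not b))
  ⊎ (cubeEnd f (not c) ≡ opposite (cubeEnd e b) × cubeEnd f c ≡ opposite (cubeEnd e (not b)))

-- A loop or an odd cycle of exchangeHats e b f c is detected as ¬ Bipartite.
cube-exchangeHats : ∀ e f → e ≢ f → ∀ b c →
  ExchangeOutcome e b f c
  ⊎ ParallelTo (exchangeHats e b f c) e ⊎ ParallelTo (exchangeHats e b f c) f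
  ⊎ ¬ Bipartite (exchangeHats e b f c)
cube-exchangeHats = toWitness {a? = FinP.all? λ e → FinP.all? λ f → ¬? (e FinP.≟ f) →-dec
  all-Bool? λ b → all-Bool? λ c →
  outcome? e b f c ⊎-dec parallelTo? (exchangeHats e b f c) e ⊎-dec parallelTo? (exchangeHats e b f c) f
  ⊎-dec ¬? (bipartite? (exchangeHats e b f c))} _
  where
  outcome? : ∀ e b f c → Dec (ExchangeOutcome e b f c)
  outcome? e b f c = (cubeEnd f c FinP.≟ cubeEnd e b) ⊎-dec (cubeEnd f (not c) FinP.≟ cubeEnd e (not b))
    ⊎-dec ((cubeEnd f (not c) FinP.≟ opposite (cubeEnd e b)) ×-dec (cubeEnd f c FinP.≟ opposite (cubeEnd e (not b))))

ExchangeOutcome⇒distances : ∀ {e b f c} → ExchangeOutcome e b f c →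
  (cubeEnd f c ≡ cubeEnd e b)
  ⊎ (cubeEnd f (not c) ≡ cubeEnd e (not b))
  ⊎ (Dist cube (cubeEnd e b) (cubeEnd f (not c)) 3 × Dist cube (cubeEnd e (not b)) (cubeEnd f c) 3)
ExchangeOutcome⇒distances (inj₁ same-plain)      = inj₁ same-plain
ExchangeOutcome⇒distances (inj₂ (inj₁ same-hat)) = inj₂ (inj₁ same-hat)
ExchangeOutcome⇒distances {e} {b} (inj₂ (inj₂ (f-hat≡ , f-plain≡))) = inj₂ (inj₂
  ( subst (λ v → Dist cube _ v 3) (sym f-hat≡) (cube-dist-opposite (cubeEnd e b))
  , subst (λ v → Dist cube _ v 3) (sym f-plain≡) (cube-dist-opposite (cubeEnd e (not b)))))

Iso-cube-unobstructed : ∀ H → Iso H cube → ∀ e f → ¬ (ParallelTo H e ⊎ ParallelTo H f ⊎ ¬ Bipartite H)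
Iso-cube-unobstructed H iso e f (inj₁ parallel) =
  ParallelTo⇒¬Simple {H} {e} parallel (Iso-Simple {H} {cube} iso cube-simple)
Iso-cube-unobstructed H iso e f (inj₂ (inj₁ parallel)) =
  ParallelTo⇒¬Simple {H} {f} parallel (Iso-Simple {H} {cube} iso cube-simple)
Iso-cube-unobstructed H iso e f (inj₂ (inj₂ ¬bipartite)) =
  ¬bipartite (Iso-Bipartite {H} {cube} iso cube-bipartite)

lemma3 : (s : ℕ) (P : Pot s) → Scenario3 P cube →
         (lab : Labeling cube s) → IsDesign cube lab → DesignIn cube lab P →
         (e f : Fin 12) → e ≢ f → (a : Fin s) → (b c : Bool) →
         lab e b ≡ plain a → lab e (not b) ≡ hat a →
         lab f c ≡ plain a → lab f (not c) ≡ hat a →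
         (cubeEnd f c ≡ cubeEnd e b)
         ⊎ (cubeEnd f (not c) ≡ cubeEnd e (not b))
         ⊎ (Dist cube (cubeEnd e b) (cubeEnd f (not c)) 3
            × Dist cube (cubeEnd e (not b)) (cubeEnd f c) 3)
lemma3 _ P scenario3 lab design inP e f e≢f _ b c _ e-hat _ f-hat =
  [ ExchangeOutcome⇒distances {e} {b} {f} {c}
  , ⊥-elim ∘ Iso-cube-unobstructed (exchangeHats e b f c) iso e f
  ]′ (cube-exchangeHats e f e≢f b c)
  where
  same-hats : uncurry lab (e , not b) ≡ uncurry lab (f , not c)
  same-hats = trans e-hat (sym f-hat)

  iso : Iso (exchangeHats e b f c) cube
  iso = Scenario3⇒rewire-Iso cube lab (swap-↔ _≟H_ (e , not b) (f , not c))
          (∘-swap-≗ _≟H_ (uncurry lab) same-hats) {P} scenario3 design inP
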